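{- For any graph $G$, $\chi_{cd}(G)\geq k(G^*)$.
   Context: Graphs are finite, simple, undirected. $G^*$ has vertex set $V(G)$ and edge set $\{uv: d_G(u,v)=2\}$; $k(\cdot)$ is the clique cover number (minimum number of cliques partitioning the vertex set). A cd-colouring of $G$ is a proper colouring in which each colour class $C$ satisfies $C\subseteq N_G[v]$ for some vertex $v$ (i.e. $C\subseteq N_G(v)$ when $|C|\ge2$); $\chi_{cd}(G)$ is the minimum number of colours in a cd-colouring. -}

module Defs where

open import Level using (0ℓ)
open import Data.Nat using (ℕ)
open import Data.Fin using (Fin)
open import Data.Product using (Σ; ∃; _×_)
open import Data.Sum using (_⊎_)
open import Relation.Nullary using (¬_)
open import Relation.Binary.PropositionalEquality using (_≡_; _≢_)

record Graph : Set₁ where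
  field
    n      : ℕ
    Adj    : Fin n → Fin n → Set
    sym    : ∀ {u v} → Adj u v → Adj v u
    irrefl : ∀ {u} → ¬ Adj u u
open Graph public

Vertex : Graph → Set
Vertex G = Fin (n G)

_∈N[_]_ : {G : Graph} → Vertex G → Vertex G → Graph → Set
_∈N[_]_ {G} u v _ = u ≡ v ⊎ Adj G u v

Dist2 : (G : Graph) → Vertex G → Vertex G → Set
Dist2 G u v = u ≢ v × ¬ Adj G u v × ∃ λ w → Adj G u w × Adj G w v

star : Graph → Graph
star G = record
  { n      = n G
  ; Adj    = Dist2 G
  ; sym    = λ { (u≢v , ¬uv , w , uw , wv) →
                 (λ e → u≢v (symm e)) , (λ vu → ¬uv (Graph.sym G vu)) ,
                 w , Graph.sym G wv , Graph.sym G uw }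
  ; irrefl = λ { (u≢u , _) → u≢u refl' }
  }
  where
    open import Relation.Binary.PropositionalEquality using () renaming (sym to symm; refl to refl')
    open import Data.Product using (_,_)

IsProperColouring : (G : Graph) (k : ℕ) → (Vertex G → Fin k) → Set
IsProperColouring G k c = ∀ u v → Adj G u v → c u ≢ c v

IsCdColouring : (G : Graph) (k : ℕ) → (Vertex G → Fin k) → Set
IsCdColouring G k c =
  IsProperColouring G k c ×
  (∀ u → ∃ λ v → ∀ w → c w ≡ c u → _∈N[_]_ {G} w v G)

-- Clique cover with (at most) k cliques: an assignment of vertices to k
-- classes, each class being a clique (possibly empty classes allowed).
IsCliqueCover : (G : Graph) (k : ℕ) → (Vertex G → Fin k) → Set
IsCliqueCover G k f = ∀ u v → f u ≡ f v → u ≢ v → Adj G u v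

HasCdColouring : Graph → ℕ → Set
HasCdColouring G k = Σ (Vertex G → Fin k) (IsCdColouring G k)

HasCliqueCover : Graph → ℕ → Set
HasCliqueCover G k = Σ (Vertex G → Fin k) (IsCliqueCover G k)

{-# OPTIONS --safe #-}
module Submission where

open import Defs
open import Data.Nat using (ℕ)
open import Data.Fin using (Fin)
open import Data.Product using (_,_)
open import Data.Sum using (inj₁; inj₂)
open import Data.Empty using (⊥-elim)
open import Relation.Binary.PropositionalEquality using (refl) renaming (sym to ≡-sym)

-- A colour class lies in some N_G[w]; properness rules out w being u or v and
-- rules out u ~ v, so w is a common neighbour of two non-adjacent vertices.
cdColouring⇒starCliqueCover : ∀ (G : Graph) {k} {c : Vertex G → Fin k} →
                              IsCdColouring G k c → IsCliqueCover (star G) k c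
cdColouring⇒starCliqueCover G (proper , classInNbhd) u v cu≡cv u≢v
  with classInNbhd u
... | w , inN[w] with inN[w] u refl | inN[w] v (≡-sym cu≡cv)
... | inj₁ refl | inj₁ refl = ⊥-elim (u≢v refl)
... | inj₁ refl | inj₂ vw   = ⊥-elim (proper v u vw (≡-sym cu≡cv))
... | inj₂ uw   | inj₁ refl = ⊥-elim (proper u v uw cu≡cv)
... | inj₂ uw   | inj₂ vw   =
  u≢v , (λ uv → proper u v uv cu≡cv) , w , uw , Graph.sym G vw

mainTheorem18 : (G : Graph) (k : ℕ) → HasCdColouring G k → HasCliqueCover (star G) k
mainTheorem18 G k (c , cd) = c , cdColouring⇒starCliqueCover G cd
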